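{- Let $\mathbf E=(E,+,{}',0,1)$ be a lattice effect algebra. Then $\mathbf E$ satisfies the unsharp contraposition law, i.e.\ $U(x\rightarrow y)=U(y'\rightarrow x')$ for all $x,y\in E$, if and only if $x'+(x\wedge y)=y+(x'\wedge y')$ for all $x,y\in E$.
   Context: An effect algebra is a partial algebra $(E,+,{}',0,1)$ of type $(2,1,0,0)$ where $+$ is a partial binary operation such that for all $x,y,z\in E$: (E1) $x+y$ is defined iff $y+x$ is defined, and then $x+y=y+x$; (E2) $(x+y)+z$ is defined iff $x+(y+z)$ is defined, and then they are equal; (E3) $x'$ is the unique $u\in E$ with $x+u=1$; (E4) if $1+x$ is defined then $x=0$. The induced order is $x\leq y$ iff $x+z=y$ for some $z$; $x+y$ is defined iff $x\leq y'$. A lattice effect algebra is one whose induced order is a lattice (meet $\wedge$). $L(A)$, $U(A)$ denote the sets of lower, resp. upper, bounds of $A\subseteq E$, $L(x,y)=L(\{x,y\})$. The implication is the subset $x\rightarrow y:=x'+L(x,y)=\{x'+u\mid u\in L(x,y)\}$. -}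

module Defs where

open import Data.Maybe using (Maybe; just; nothing; _>>=_)
open import Data.Product using (Σ; ∃; _×_; _,_)
open import Relation.Binary.PropositionalEquality using (_≡_)

-- An effect algebra (E, +, ′, 0, 1); the partial operation + is modelled as
-- a total function into Maybe E (nothing = undefined).
record EffectAlgebra : Set₁ where
  field
    Carrier : Set
    _⊕_     : Carrier → Carrier → Maybe Carrier
    _′      : Carrier → Carrier
    𝟎 𝟏     : Carrier
    comm    : ∀ x y → x ⊕ y ≡ y ⊕ x
    -- (E2) (x+y)+z defined iff x+(y+z) defined, and then equal
    assoc   : ∀ x y z → ((x ⊕ y) >>= λ s → s ⊕ z) ≡ ((y ⊕ z) >>= λ t → x ⊕ t)
    ′-sum   : ∀ x → x ⊕ (x ′) ≡ just 𝟏
    ′-uniq  : ∀ x u → x ⊕ u ≡ just 𝟏 → u ≡ x ′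
    zero-one : ∀ x s → 𝟏 ⊕ x ≡ just s → x ≡ 𝟎

  infix 4 _≤_
  _≤_ : Carrier → Carrier → Set
  x ≤ y = ∃ λ z → x ⊕ z ≡ just y

record LatticeEffectAlgebra : Set₁ where
  field
    effectAlgebra : EffectAlgebra
  open EffectAlgebra effectAlgebra public
  field
    _∧_   : Carrier → Carrier → Carrier
    _∨_   : Carrier → Carrier → Carrier
    ∧-lb₁ : ∀ x y → (x ∧ y) ≤ x
    ∧-lb₂ : ∀ x y → (x ∧ y) ≤ y
    ∧-glb : ∀ x y z → z ≤ x → z ≤ y → z ≤ (x ∧ y)
    ∨-ub₁ : ∀ x y → x ≤ (x ∨ y)
    ∨-ub₂ : ∀ x y → y ≤ (x ∨ y)
    ∨-lub : ∀ x y z → x ≤ z → y ≤ z → (x ∨ y) ≤ z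

module _ (𝐄 : EffectAlgebra) where
  open EffectAlgebra 𝐄

  Subset : Set₁
  Subset = Carrier → Set

  L₂ : Carrier → Carrier → Subset
  L₂ x y u = (u ≤ x) × (u ≤ y)

  U : Subset → Subset
  U A w = ∀ a → A a → a ≤ w

  Imp : Carrier → Carrier → Subset
  Imp x y w = ∃ λ u → L₂ x y u × ((x ′) ⊕ u ≡ just w)

  _≐_ : Subset → Subset → Set
  A ≐ B = ∀ w → (A w → B w) × (B w → A w)

  UnsharpContraposition : Set
  UnsharpContraposition = ∀ x y → U (Imp x y) ≐ U (Imp (y ′) (x ′))

-- Since x ∧ y is the greatest element of L(x,y) and + is monotone, x′ + (x ∧ y)
-- is the greatest element of x → y, so U(x → y) is the principal filter it
-- generates. Likewise U(y′ → x′) is the principal filter generated by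
-- y + (x′ ∧ y′), and two principal filters coincide iff their generators do.
module Submission where

open import Defs
open import Function.Base using (id)
open import Function.Bundles using (_⇔_; mk⇔; Equivalence)
open import Function.Properties.Equivalence using () renaming (trans to ⇔-trans)
open import Relation.Binary.PropositionalEquality using (_≡_; refl; sym; trans; cong; subst; module ≡-Reasoning)
open import Data.Maybe using (Maybe; just; _>>=_)
open import Data.Maybe.Properties using (just-injective)
open import Data.Product using (∃; _×_; _,_; proj₁; proj₂)

>>=-just⁻¹ : {A B : Set} (m : Maybe A) (f : A → Maybe B) {s : B} →
             (m >>= f) ≡ just s → ∃ λ p → (m ≡ just p) × (f p ≡ just s)
>>=-just⁻¹ (just p) f e = p , refl , e

≡⇔just-≡ : {A : Set} {m n : Maybe A} {s t : A} →
           m ≡ just s → n ≡ just t → (s ≡ t) ⇔ (m ≡ n)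
≡⇔just-≡ refl refl = mk⇔ (cong just) just-injective

module EffectAlgebraProperties (𝐄 : EffectAlgebra) where
  open EffectAlgebra 𝐄

  ′-involutive : ∀ x → (x ′) ′ ≡ x
  ′-involutive x = sym (′-uniq (x ′) x (trans (comm (x ′) x) (′-sum x)))

  ⊕-monoʳ-≤ : ∀ {u v a s} → u ≤ v → a ⊕ v ≡ just s → ∃ λ t → (a ⊕ u ≡ just t) × (t ≤ s)
  ⊕-monoʳ-≤ {u} {v} {a} (z , u⊕z) a⊕v
    with p , a⊕u , p⊕z ← >>=-just⁻¹ (a ⊕ u) (λ p → p ⊕ z)
           (trans (assoc a u z) (trans (cong (_>>= a ⊕_) u⊕z) a⊕v))
    = p , a⊕u , z , p⊕z

  ≤-trans : ∀ {x y z} → x ≤ y → y ≤ z → x ≤ z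
  ≤-trans {x} (a , x⊕a) (b , y⊕b)
    with c , _ , x⊕c ← >>=-just⁻¹ (a ⊕ b) (x ⊕_)
           (trans (sym (assoc x a b)) (trans (cong (_>>= _⊕ b) x⊕a) y⊕b))
    = c , x⊕c

  𝟏⊕𝟎≡𝟏 : 𝟏 ⊕ 𝟎 ≡ just 𝟏
  𝟏⊕𝟎≡𝟏 = subst (λ z → 𝟏 ⊕ z ≡ just 𝟏) (zero-one (𝟏 ′) 𝟏 (′-sum 𝟏)) (′-sum 𝟏)

  ′-⊕-identityʳ : ∀ x → (x ′) ⊕ 𝟎 ≡ just (x ′)
  ′-⊕-identityʳ x
    with p , x′⊕𝟎 , x⊕p ← >>=-just⁻¹ ((x ′) ⊕ 𝟎) (x ⊕_)
           (trans (sym (assoc x (x ′) 𝟎)) (trans (cong (_>>= _⊕ 𝟎) (′-sum x)) 𝟏⊕𝟎≡𝟏))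
    = trans x′⊕𝟎 (cong just (′-uniq x p x⊕p))

  ⊕-identityʳ : ∀ x → x ⊕ 𝟎 ≡ just x
  ⊕-identityʳ x = subst (λ z → z ⊕ 𝟎 ≡ just z) (′-involutive x) (′-⊕-identityʳ (x ′))

  ≤-refl : ∀ x → x ≤ x
  ≤-refl x = 𝟎 , ⊕-identityʳ x

  ⊕≡self⇒𝟎 : ∀ x c → x ⊕ c ≡ just x → c ≡ 𝟎
  ⊕≡self⇒𝟎 x c x⊕c = zero-one c 𝟏 (begin
      𝟏 ⊕ c                  ≡⟨ cong (_>>= _⊕ c) x′⊕x ⟨
      ((x ′) ⊕ x >>= _⊕ c)   ≡⟨ assoc (x ′) x c ⟩
      (x ⊕ c >>= (x ′) ⊕_)   ≡⟨ cong (_>>= (x ′) ⊕_) x⊕c ⟩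
      (x ′) ⊕ x              ≡⟨ x′⊕x ⟩
      just 𝟏                 ∎)
    where
    open ≡-Reasoning
    x′⊕x : (x ′) ⊕ x ≡ just 𝟏
    x′⊕x = trans (comm (x ′) x) (′-sum x)

  ⊕≡𝟎⇒ʳ≡𝟎 : ∀ a b → a ⊕ b ≡ just 𝟎 → b ≡ 𝟎
  ⊕≡𝟎⇒ʳ≡𝟎 a b a⊕b
    with p , b⊕𝟏 , _ ← >>=-just⁻¹ (b ⊕ 𝟏) (a ⊕_)
           (trans (sym (assoc a b 𝟏)) (trans (cong (_>>= _⊕ 𝟏) a⊕b) (trans (comm 𝟎 𝟏) 𝟏⊕𝟎≡𝟏)))
    = zero-one b p (trans (comm 𝟏 b) b⊕𝟏)

  ≤-antisym : ∀ {x y} → x ≤ y → y ≤ x → x ≡ y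
  ≤-antisym {x} (a , x⊕a) (b , y⊕b)
    with c , a⊕b , x⊕c ← >>=-just⁻¹ (a ⊕ b) (x ⊕_)
           (trans (sym (assoc x a b)) (trans (cong (_>>= _⊕ b) x⊕a) y⊕b))
    with refl ← ⊕≡self⇒𝟎 x c x⊕c
    = just-injective (trans (sym (⊕-identityʳ x))
        (trans (cong (x ⊕_) (sym (⊕≡𝟎⇒ʳ≡𝟎 b a (trans (comm b a) a⊕b)))) x⊕a))

  ′-⊕-defined : ∀ {a c} → c ≤ a → ∃ λ t → (a ′) ⊕ c ≡ just t
  ′-⊕-defined {a} c≤a
    with t , a′⊕c , _ ← ⊕-monoʳ-≤ c≤a (trans (comm (a ′) a) (′-sum a))
    = t , a′⊕c

  ↑_ : Carrier → Subset 𝐄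
  (↑ t) w = t ≤ w

  IsGreatest : Subset 𝐄 → Carrier → Set
  IsGreatest A c = A c × (∀ u → A u → u ≤ c)

  U-Imp≐↑ : ∀ {a b c t} → IsGreatest (L₂ 𝐄 a b) c → (a ′) ⊕ c ≡ just t →
            _≐_ 𝐄 (U 𝐄 (Imp 𝐄 a b)) (↑ t)
  U-Imp≐↑ {c = c} {t} (c∈L , c-greatest) a′⊕c w = (λ t∈U → t∈U t (c , c∈L , a′⊕c)) , t≤w⇒w∈U
    where
    t≤w⇒w∈U : t ≤ w → U 𝐄 (Imp 𝐄 _ _) w
    t≤w⇒w∈U t≤w _ (u , u∈L , a′⊕u)
      with t′ , a′⊕u′ , t′≤t ← ⊕-monoʳ-≤ (c-greatest u u∈L) a′⊕c
      with refl ← just-injective (trans (sym a′⊕u) a′⊕u′)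
      = ≤-trans t′≤t t≤w

  ≐-resp-⇔ : ∀ {A A′ B B′} → _≐_ 𝐄 A A′ → _≐_ 𝐄 B B′ → (_≐_ 𝐄 A B) ⇔ (_≐_ 𝐄 A′ B′)
  ≐-resp-⇔ A≐A′ B≐B′ = mk⇔
    (λ A≐B w → (λ a → proj₁ (B≐B′ w) (proj₁ (A≐B w) (proj₂ (A≐A′ w) a)))
             , (λ b → proj₁ (A≐A′ w) (proj₂ (A≐B w) (proj₂ (B≐B′ w) b))))
    (λ A′≐B′ w → (λ a → proj₂ (B≐B′ w) (proj₁ (A′≐B′ w) (proj₁ (A≐A′ w) a)))
               , (λ b → proj₂ (A≐A′ w) (proj₂ (A′≐B′ w) (proj₁ (B≐B′ w) b))))

  ↑-≐⇔≡ : ∀ {s t} → (_≐_ 𝐄 (↑ s) (↑ t)) ⇔ (s ≡ t)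
  ↑-≐⇔≡ {s} {t} = mk⇔
    (λ ↑s≐↑t → ≤-antisym (proj₂ (↑s≐↑t t) (≤-refl t)) (proj₁ (↑s≐↑t s) (≤-refl s)))
    (λ { refl w → id , id })

module LatticeEffectAlgebraProperties (𝐄 : LatticeEffectAlgebra) where
  open LatticeEffectAlgebra 𝐄
  open EffectAlgebraProperties effectAlgebra

  ∧-isGreatest : ∀ {x y} → IsGreatest (L₂ effectAlgebra x y) (x ∧ y)
  ∧-isGreatest {x} {y} = (∧-lb₁ x y , ∧-lb₂ x y) , λ u (u≤x , u≤y) → ∧-glb x y u u≤x u≤y

  ∧-isGreatest-swap : ∀ {x y} → IsGreatest (L₂ effectAlgebra y x) (x ∧ y)
  ∧-isGreatest-swap {x} {y} = (∧-lb₂ x y , ∧-lb₁ x y) , λ u (u≤y , u≤x) → ∧-glb x y u u≤x u≤y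

  U-contraposition⇔ : ∀ x y →
    (_≐_ effectAlgebra (U effectAlgebra (Imp effectAlgebra x y))
                       (U effectAlgebra (Imp effectAlgebra (y ′) (x ′))))
    ⇔ ((x ′) ⊕ (x ∧ y) ≡ y ⊕ ((x ′) ∧ (y ′)))
  U-contraposition⇔ x y
    with t , x′⊕x∧y ← ′-⊕-defined (∧-lb₁ x y)
       | s , y′′⊕x′∧y′ ← ′-⊕-defined (∧-lb₂ (x ′) (y ′))
    = ⇔-trans (≐-resp-⇔ (U-Imp≐↑ ∧-isGreatest x′⊕x∧y) (U-Imp≐↑ ∧-isGreatest-swap y′′⊕x′∧y′))
      (⇔-trans ↑-≐⇔≡
        (≡⇔just-≡ x′⊕x∧y (subst (λ z → z ⊕ ((x ′) ∧ (y ′)) ≡ just s) (′-involutive y) y′′⊕x′∧y′)))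

proposition16 : (𝐄 : LatticeEffectAlgebra) → let open LatticeEffectAlgebra 𝐄 in UnsharpContraposition effectAlgebra ⇔ (∀ x y → (x ′) ⊕ (x ∧ y) ≡ y ⊕ ((x ′) ∧ (y ′)))
proposition16 𝐄 = mk⇔
  (λ contraposition x y → Equivalence.to (U-contraposition⇔ x y) (contraposition x y))
  (λ equation x y → Equivalence.from (U-contraposition⇔ x y) (equation x y))
  where open LatticeEffectAlgebraProperties 𝐄
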